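{- Let $i$ and $k$ be integers with $1<i\leq k$. Then the function $g_k$ is unbounded on the class of graphs $H$ with $\chi(H)=i$, and the function $h_k$ is unbounded on the class of graphs $H$ with $\chi(H)=i$. That is, for every positive integer $N$ there is a graph $H$ with $\chi(H)=i$ and $g_k(H)\geq N$, and there is a graph $H'$ with $\chi(H')=i$ and $h_k(H')\geq N$.
   Context: For a graph $H$ and an integer $k\geq\chi(H)$, a proper $k$-coloring of $H$ is a map $\phi:V(H)\to[k]=\{1,\ldots,k\}$ with $\phi(u)\neq\phi(v)$ for every edge $uv$. For a positive integer $j$, the $j$-localized $k$-coloring graph $G^j_k(H)$ has as vertices the proper $k$-colorings of $H$, two distinct colorings being adjacent if $H$ contains a connected subgraph on at most $j$ vertices that contains every vertex on which the two colorings differ. The $k$-color mixing number $g_k(H)$ is the least positive integer $j$ such that $G^j_k(H)$ is connected, and the $k$-color Gray code number $h_k(H)$ is the least positive integer $j$ such that $G^j_k(H)$ is Hamiltonian (complete graphs, including those on one or two vertices, are regarded as Hamiltonian). These exist whenever $k\geq\chi(H)$. -}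

module Defs where

open import Data.Nat using (ℕ; _≤_; _<_)
open import Data.Bool using (Bool; true; false)
open import Data.Fin using (Fin)
open import Data.Fin.Subset using (Subset; _∈_; ∣_∣)
open import Data.Vec using (Vec; lookup)
open import Data.List using (List; _∷_; []; _++_; length)
open import Data.List.Relation.Unary.All using (All)
open import Data.List.Relation.Unary.Linked using (Linked)
open import Data.List.Relation.Unary.Unique.Propositional using (Unique)
import Data.List.Membership.Propositional as LM
open import Data.Product using (Σ; ∃; _×_)
open import Data.Sum using (_⊎_)
open import Data.Empty using (⊥)
open import Relation.Nullary using (¬_)
open import Relation.Binary.PropositionalEquality using (_≡_; _≢_)
open import Relation.Binary.Construct.Closure.ReflexiveTransitive using (Star)

record Graph : Set where
  field
    n      : ℕ
    adj    : Fin n → Fin n → Bool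
    sym    : ∀ u v → adj u v ≡ adj v u
    irrefl : ∀ v → adj v v ≡ false
open Graph public

Vertex : Graph → Set
Vertex H = Fin (n H)

Coloring : Graph → ℕ → Set
Coloring H k = Vec (Fin k) (n H)

Proper : (H : Graph) {k : ℕ} → Coloring H k → Set
Proper H φ = ∀ u v → adj H u v ≡ true → lookup φ u ≢ lookup φ v

Colorable : Graph → ℕ → Set
Colorable H k = Σ (Coloring H k) (Proper H)

ChromaticNumber : Graph → ℕ → Set
ChromaticNumber H i = Colorable H i × (∀ m → m < i → ¬ Colorable H m)

data WalkIn (H : Graph) (S : Subset (n H)) : Vertex H → Vertex H → Set where
  here : ∀ {u} → u ∈ S → WalkIn H S u u
  step : ∀ {u w v} → u ∈ S → adj H u w ≡ true → WalkIn H S w v → WalkIn H S u v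

ConnectedSet : (H : Graph) → Subset (n H) → Set
ConnectedSet H S = ∀ u v → u ∈ S → v ∈ S → WalkIn H S u v

LocAdj : (H : Graph) (k j : ℕ) → Coloring H k → Coloring H k → Set
LocAdj H k j φ ψ =
  φ ≢ ψ ×
  ∃ λ (S : Subset (n H)) → ∣ S ∣ ≤ j × ConnectedSet H S ×
    (∀ v → lookup φ v ≢ lookup ψ v → v ∈ S)

PColoring : Graph → ℕ → Set
PColoring H k = Colorable H k

PAdj : (H : Graph) (k j : ℕ) → PColoring H k → PColoring H k → Set
PAdj H k j φ ψ = LocAdj H k j (Data.Product.proj₁ φ) (Data.Product.proj₁ ψ)

ColGraphConnected : (H : Graph) (k j : ℕ) → Set
ColGraphConnected H k j = ∀ (φ ψ : PColoring H k) → Star (PAdj H k j) φ ψ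

ColGraphComplete : (H : Graph) (k j : ℕ) → Set
ColGraphComplete H k j =
  ∀ (φ ψ : PColoring H k) → Data.Product.proj₁ φ ≢ Data.Product.proj₁ ψ → PAdj H k j φ ψ

HamCycle : (H : Graph) (k j : ℕ) → List (Coloring H k) → Set
HamCycle H k j [] = ⊥
HamCycle H k j (x ∷ xs) =
  3 ≤ length (x ∷ xs) ×
  All (Proper H) (x ∷ xs) ×
  Unique (x ∷ xs) ×
  (∀ (φ : PColoring H k) → Data.Product.proj₁ φ LM.∈ (x ∷ xs)) ×
  Linked (LocAdj H k j) ((x ∷ xs) ++ (x ∷ []))

-- Hamiltonian, with complete graphs (incl. on 1 or 2 vertices) regarded Hamiltonian.
ColGraphHamiltonian : (H : Graph) (k j : ℕ) → Set
ColGraphHamiltonian H k j =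
  ColGraphComplete H k j ⊎ ∃ λ (L : List (Coloring H k)) → HamCycle H k j L

IsMixingNumber : (H : Graph) (k g : ℕ) → Set
IsMixingNumber H k g =
  1 ≤ g × ColGraphConnected H k g × (∀ j → 1 ≤ j → j < g → ¬ ColGraphConnected H k j)

IsGrayCodeNumber : (H : Graph) (k h : ℕ) → Set
IsGrayCodeNumber H k h =
  1 ≤ h × ColGraphHamiltonian H k h × (∀ j → 1 ≤ j → j < h → ¬ ColGraphHamiltonian H k j)

module Submission where

-- Call a proper k-coloring β of a connected graph B frozen if every vertex
-- sees each of the other k - 1 colors on a neighbor.  In the blow-up B[N], where
-- each vertex becomes N independent copies, recoloring one vertex u to a color d
-- forces recoloring all N copies of the neighbor of u's original colored d, so
-- the lifted coloring is an isolated vertex of G^j_k(B[N]) whenever j < N; hence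
-- G^j_k(B[N]) is neither connected nor Hamiltonian.  Since B[N] is connected,
-- G^j_k(B[N]) is complete for j = |V(B[N])|, and χ(B[N]) = χ(B).  Frozen bases
-- exist: K_2 for k = 2, and K_i × K_k (categorical product) for k ≥ 3.

open import Defs hiding (sym)
open import Data.Nat using (ℕ; zero; suc; _+_; _*_; _≤_; _<_; _≤?_; z≤n; s≤s)
open import Data.Nat.Properties
  using ( ≤-refl; ≤-trans; <-≤-trans; ≤-<-trans; +-suc; +-identityʳ; +-mono-≤; n≮n; ≮⇒≥
        ; m<1+n⇒m<n∨m≡n)
open import Data.Bool using (true; false)
import Data.Bool.Properties as Bool
open import Data.Fin using (Fin; zero; suc; combine; remQuot; inject≤) renaming (_≟_ to _≟ᶠ_)
import Data.Fin.Properties as Fin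
open import Data.Fin.Subset using (Subset; ⊤; ∣_∣) renaming (_∈_ to _∈ˢ_)
open import Data.Fin.Subset.Properties
  using (∈⊤; ∣⊤∣≡n; x∈p⇒∣p-x∣<∣p∣; anySubset?) renaming (_∈?_ to _∈ˢ?_)
open import Data.Vec using (Vec; []; _∷_; lookup; tabulate; map; splitAt) renaming (_++_ to _++ᵛ_)
open import Data.Vec.Properties
  using ( ≡-dec; lookup∘tabulate; tabulate∘lookup; tabulate-cong; lookup-map; lookup-++ˡ; lookup-++ʳ
        ; []=⇒lookup; lookup⇒[]=)
open import Data.List using (List; []; _∷_; _++_; length; filter; allFin; cartesianProductWith)
open import Data.List.Properties using (filter-notAll)
open import Data.List.Relation.Unary.Any as Any using (Any; here; there; satisfied; any?)
open import Data.List.Relation.Unary.All as All using (all?)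
open import Data.List.Relation.Unary.AllPairs using ([]; _∷_)
open import Data.List.Relation.Unary.Linked using (Linked; _∷_; linked?)
open import Data.List.Relation.Unary.Unique.Propositional using (Unique)
open import Data.List.Relation.Unary.Unique.DecPropositional using (unique?)
open import Data.List.Membership.Propositional using (_∈_; lose)
open import Data.List.Membership.Propositional.Properties
  using (∈-filter⁺; ∈-filter⁻; ∈-cartesianProductWith⁺; ∈-allFin; ∈-++⁺ˡ; ∈-++⁻)
import Data.List.Membership.DecPropositional as DecMembership
open import Data.Product using (∃; _×_; _,_; proj₁; proj₂)
open import Data.Sum using (_⊎_; inj₁; inj₂; [_,_])
open import Data.Empty using (⊥-elim)
open import Function using (_∘_; id)
open import Function.Bundles using (mk⇔)
open import Relation.Nullary using (¬_; Dec; yes; no; ¬?; does)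
open import Relation.Nullary.Decidable
  using (map′; _×-dec_; _→-dec_; _⊎-dec_; decidable-stable; does-⇔; dec-true; dec-false)
open import Relation.Binary.Definitions using (DecidableEquality)
open import Relation.Binary.PropositionalEquality
  using (_≡_; _≢_; refl; sym; ≢-sym; trans; cong; cong₂; subst; module ≡-Reasoning)
open import Relation.Binary.Construct.Closure.ReflexiveTransitive using (Star; ε; _◅_; _◅◅_)

record Enumeration (A : Set) : Set where
  field
    elements : List A
    complete : ∀ a → a ∈ elements
open Enumeration

∀? : ∀ {A : Set} {P : A → Set} → Enumeration A → (∀ a → Dec (P a)) → Dec (∀ a → P a)
∀? E P? = map′ (λ all a → All.lookup all (complete E a)) (λ f → All.tabulate λ {a} _ → f a)
               (all? P? (elements E))

vectorsOver : {A : Set} → List A → (n : ℕ) → List (Vec A n)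
vectorsOver xs zero    = [] ∷ []
vectorsOver xs (suc n) = cartesianProductWith _∷_ xs (vectorsOver xs n)

listsUpTo : {A : Set} → List A → ℕ → List (List A)
listsUpTo xs zero    = [] ∷ []
listsUpTo xs (suc m) = [] ∷ cartesianProductWith _∷_ xs (listsUpTo xs m)

module _ {A : Set} (E : Enumeration A) where

  vectorEnumeration : ∀ n → Enumeration (Vec A n)
  vectorEnumeration n = record { elements = vectorsOver (elements E) n ; complete = listed }
    where
    listed : ∀ {n} (v : Vec A n) → v ∈ vectorsOver (elements E) n
    listed []      = here refl
    listed (x ∷ v) = ∈-cartesianProductWith⁺ _∷_ (complete E x) (listed v)

  ∈-listsUpTo : ∀ m (L : List A) → length L ≤ m → L ∈ listsUpTo (elements E) m
  ∈-listsUpTo zero    []      _       = here refl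
  ∈-listsUpTo (suc m) []      _       = here refl
  ∈-listsUpTo (suc m) (x ∷ L) (s≤s ≤m) =
    there (∈-cartesianProductWith⁺ _∷_ (complete E x) (∈-listsUpTo m L ≤m))

module Removal {A : Set} (_≟_ : DecidableEquality A) where

  _∖_ : List A → A → List A
  L ∖ x = filter (λ a → ¬? (a ≟ x)) L

  ∈-∖⁺ : ∀ {L a x} → a ∈ L → a ≢ x → a ∈ L ∖ x
  ∈-∖⁺ = ∈-filter⁺ (λ a → ¬? (a ≟ _))

  ∈-∖⁻ : ∀ {L a x} → a ∈ L ∖ x → a ∈ L × a ≢ x
  ∈-∖⁻ = ∈-filter⁻ (λ a → ¬? (a ≟ _))

  ∖-shrinks : ∀ {L x} → x ∈ L → length (L ∖ x) < length L
  ∖-shrinks {L} x∈L = filter-notAll _ L (Any.map (λ x≡a a≢x → a≢x (sym x≡a)) x∈L)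

  unique-length : ∀ {xs L} → Unique xs → (∀ {a} → a ∈ xs → a ∈ L) → length xs ≤ length L
  unique-length []              _   = z≤n
  unique-length {x ∷ xs} {L} (x∉xs ∷ unique) sub =
    ≤-trans (s≤s (unique-length unique inRest)) (∖-shrinks {L} (sub (here refl)))
    where
    inRest : ∀ {a} → a ∈ xs → a ∈ L ∖ x
    inRest a∈xs = ∈-∖⁺ (sub (there a∈xs)) (λ a≡x → All.lookup x∉xs a∈xs (sym a≡x))

-- Reachability along a decidable relation R inside a finite list L is decidable:
-- a path from x either stops at once or leaves x and never returns to it.
module Reachability {A : Set} (_≟_ : DecidableEquality A)
                    (R : A → A → Set) (R? : ∀ x y → Dec (R x y)) where
  open Removal _≟_
  open DecMembership _≟_ using (_∈?_)

  data PathIn (L : List A) : A → A → Set where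
    here : ∀ {x} → x ∈ L → PathIn L x x
    step : ∀ {x y z} → x ∈ L → R x y → PathIn L y z → PathIn L x z

  source : ∀ {L x y} → PathIn L x y → x ∈ L
  source (here x∈L)     = x∈L
  source (step x∈L _ _) = x∈L

  widen : ∀ {L x a b} → PathIn (L ∖ x) a b → PathIn L a b
  widen (here a∈)       = here (proj₁ (∈-∖⁻ a∈))
  widen (step a∈ r rest) = step (proj₁ (∈-∖⁻ a∈)) r (widen rest)

  -- Cutting a path to y ≠ x at its last visit to x.
  cutAt : ∀ {L x a y} → x ≢ y → PathIn L a y →
          PathIn (L ∖ x) a y ⊎ ∃ λ w → R x w × PathIn (L ∖ x) w y
  cutAt x≢y (here a∈L) = inj₁ (here (∈-∖⁺ a∈L (≢-sym x≢y)))
  cutAt {x = x} {a} x≢y (step {y = b} a∈L r rest) with cutAt x≢y rest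
  ... | inj₂ exit = inj₂ exit
  ... | inj₁ rest′ with a ≟ x
  ...   | yes refl = inj₂ (b , r , rest′)
  ...   | no a≢x   = inj₁ (step (∈-∖⁺ a∈L a≢x) r rest′)

  search : ∀ fuel L → length L ≤ fuel → ∀ x y → Dec (PathIn L x y)
  leave  : ∀ fuel L {x y} → x ∈ L → x ≢ y → length (L ∖ x) < fuel → Dec (PathIn L x y)

  search fuel L bound x y with x ∈? L
  ... | no x∉L = no (x∉L ∘ source)
  ... | yes x∈L with x ≟ y
  ...   | yes refl = yes (here x∈L)
  ...   | no x≢y   = leave fuel L x∈L x≢y (<-≤-trans (∖-shrinks {L} x∈L) bound)

  leave (suc fuel) L {x} {y} x∈L x≢y (s≤s bound) =
    map′ viaExit toExit (any? (λ w → R? x w ×-dec search fuel (L ∖ x) bound w y) (L ∖ x))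
    where
    viaExit : Any (λ w → R x w × PathIn (L ∖ x) w y) (L ∖ x) → PathIn L x y
    viaExit exit = let (_ , r , p) = satisfied exit in step x∈L r (widen p)
    toExit : PathIn L x y → Any (λ w → R x w × PathIn (L ∖ x) w y) (L ∖ x)
    toExit p with cutAt x≢y p
    ... | inj₁ q           = ⊥-elim (proj₂ (∈-∖⁻ {L} (source q)) refl)
    ... | inj₂ (w , r , q) = lose (source q) (r , q)

  path? : ∀ L x y → Dec (PathIn L x y)
  path? L = search (length L) L ≤-refl

module _ (P : ℕ → Set) (P? : ∀ j → Dec (P j)) where

  private
    searchFrom : ∀ s d → (∀ j → j < s → ¬ P j) → P (d + s) →
                 ∃ λ g → P g × (∀ j → j < g → ¬ P j)
    searchFrom s zero    below p = s , p , below
    searchFrom s (suc d) below p with P? s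
    ... | yes ps = s , ps , below
    ... | no ¬ps = searchFrom (suc s) d below′ (subst P (sym (+-suc d s)) p)
      where
      below′ : ∀ j → j < suc s → ¬ P j
      below′ j j<1+s with m<1+n⇒m<n∨m≡n j<1+s
      ... | inj₁ j<s  = below j j<s
      ... | inj₂ refl = ¬ps

  least : ∀ m → P m → ∃ λ g → P g × (∀ j → j < g → ¬ P j)
  least m p = searchFrom 0 m (λ _ ()) (subst P (sym (+-identityʳ m)) p)

leastPositiveAbove : (P : ℕ → Set) → (∀ j → Dec (P j)) → ∀ N m → 1 ≤ N →
  (∀ j → j < N → ¬ P j) → P m → ∃ λ g → (1 ≤ g × P g × (∀ j → 1 ≤ j → j < g → ¬ P j)) × N ≤ g
leastPositiveAbove P P? N m 1≤N below pm with g , pg , minimal ← least P P? m pm =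
  g , (≤-trans 1≤N N≤g , pg , λ j _ → minimal j) , N≤g
  where
  N≤g : N ≤ g
  N≤g = ≮⇒≥ λ g<N → below g g<N pg

_≟ᶜ_ : ∀ {k m} → DecidableEquality (Vec (Fin k) m)
_≟ᶜ_ = ≡-dec _≟ᶠ_

finEnumeration : ∀ n → Enumeration (Fin n)
finEnumeration n = record { elements = allFin n ; complete = ∈-allFin }

colorings : (H : Graph) (k : ℕ) → Enumeration (Coloring H k)
colorings H k = vectorEnumeration (finEnumeration k) (n H)

proper? : (H : Graph) {k : ℕ} (φ : Coloring H k) → Dec (Proper H φ)
proper? H φ = Fin.all? λ u → Fin.all? λ v →
  (adj H u v Bool.≟ true) →-dec ¬? (lookup φ u ≟ᶠ lookup φ v)

module WalkSearch (H : Graph) where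
  open Reachability _≟ᶠ_ (λ u v → adj H u v ≡ true) (λ u v → adj H u v Bool.≟ true)

  members : Subset (n H) → List (Vertex H)
  members S = filter (_∈ˢ? S) (allFin (n H))

  member⁺ : ∀ {S u} → u ∈ˢ S → u ∈ members S
  member⁺ {S} u∈S = ∈-filter⁺ (_∈ˢ? S) (∈-allFin _) u∈S

  member⁻ : ∀ {S u} → u ∈ members S → u ∈ˢ S
  member⁻ {S} u∈ = proj₂ (∈-filter⁻ (_∈ˢ? S) {xs = allFin (n H)} u∈)

  toPath : ∀ {S u v} → WalkIn H S u v → PathIn (members S) u v
  toPath (here u∈S)        = here (member⁺ u∈S)
  toPath (step u∈S e walk) = step (member⁺ u∈S) e (toPath walk)

  toWalk : ∀ {S u v} → PathIn (members S) u v → WalkIn H S u v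
  toWalk {S} (here u∈)        = here (member⁻ {S} u∈)
  toWalk {S} (step u∈ e path) = step (member⁻ {S} u∈) e (toWalk path)

  walkIn? : ∀ S u v → Dec (WalkIn H S u v)
  walkIn? S u v = map′ toWalk toPath (path? (members S) u v)

connectedSet? : (H : Graph) (S : Subset (n H)) → Dec (ConnectedSet H S)
connectedSet? H S = Fin.all? λ u → Fin.all? λ v →
  (u ∈ˢ? S) →-dec (v ∈ˢ? S) →-dec WalkSearch.walkIn? H S u v

locAdj? : ∀ H k j (φ ψ : Coloring H k) → Dec (LocAdj H k j φ ψ)
locAdj? H k j φ ψ = ¬? (φ ≟ᶜ ψ) ×-dec anySubset? λ S →
  (∣ S ∣ ≤? j) ×-dec connectedSet? H S ×-dec
  Fin.all? λ v → ¬? (lookup φ v ≟ᶠ lookup ψ v) →-dec (v ∈ˢ? S)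

locAdj-sym : ∀ {H k j} {φ ψ : Coloring H k} → LocAdj H k j φ ψ → LocAdj H k j ψ φ
locAdj-sym (φ≢ψ , S , small , conn , covers) =
  ≢-sym φ≢ψ , S , small , conn , λ v differ → covers v (≢-sym differ)

TwoColorings : Graph → ℕ → Set
TwoColorings H k = ∃ λ (φ : PColoring H k) → ∃ λ (ψ : PColoring H k) → proj₁ φ ≢ proj₁ ψ

another : ∀ {H k} → TwoColorings H k → (φ : PColoring H k) → ∃ λ χ → proj₁ χ ≢ proj₁ φ
another (α , β , α≢β) φ with proj₁ α ≟ᶜ proj₁ φ
... | yes α≡φ = β , λ β≡φ → α≢β (trans α≡φ (sym β≡φ))
... | no α≢φ  = α , α≢φ

-- Since Star relates colorings together with their properness proofs, a
-- coloring is joined to itself by a detour through a distinct one.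
connectedFromDistinct : ∀ {H k j} → TwoColorings H k →
  (∀ φ ψ → proj₁ φ ≢ proj₁ ψ → Star (PAdj H k j) φ ψ) → ColGraphConnected H k j
connectedFromDistinct {H} two join φ ψ with proj₁ φ ≟ᶜ proj₁ ψ
... | no φ≢ψ  = join φ ψ φ≢ψ
... | yes φ≡ψ = let (χ , χ≢φ) = another {H} two φ in
  join φ χ (≢-sym χ≢φ) ◅◅ join χ ψ (λ χ≡ψ → χ≢φ (trans χ≡ψ (sym φ≡ψ)))

complete⇒connected : ∀ {H k j} → TwoColorings H k → ColGraphComplete H k j → ColGraphConnected H k j
complete⇒connected two complete = connectedFromDistinct two λ φ ψ φ≢ψ → complete φ ψ φ≢ψ ◅ ε

module ColoringSearch (H : Graph) (k j : ℕ) where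
  open Reachability _≟ᶜ_ (LocAdj H k j) (locAdj? H k j) public

  properColorings : List (Coloring H k)
  properColorings = filter (proper? H) (elements (colorings H k))

  listed : ∀ {c} → Proper H c → c ∈ properColorings
  listed {c} p = ∈-filter⁺ (proper? H) (complete (colorings H k) c) p

  listedProper : ∀ {c} → c ∈ properColorings → Proper H c
  listedProper c∈ = proj₂ (∈-filter⁻ (proper? H) {xs = elements (colorings H k)} c∈)

  fromStar : ∀ {φ ψ} → Star (PAdj H k j) φ ψ → PathIn properColorings (proj₁ φ) (proj₁ ψ)
  fromStar {_ , p} ε            = here (listed p)
  fromStar {_ , p} (adj ◅ rest) = step (listed p) adj (fromStar rest)

  toStar : ∀ {c d} → PathIn properColorings c d → (p : Proper H c) (q : Proper H d) →
           c ≡ d ⊎ Star (PAdj H k j) (c , p) (d , q)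
  toStar (here _)            p q = inj₁ refl
  toStar (step _ adj rest) p q with toStar rest (listedProper (source rest)) q
  ... | inj₁ refl = inj₂ (adj ◅ ε)
  ... | inj₂ path = inj₂ (adj ◅ path)

connected? : ∀ H k j → TwoColorings H k → Dec (ColGraphConnected H k j)
connected? H k j two = map′ joined (λ conn c d p q _ → fromStar (conn (c , p) (d , q))) paths?
  where
  open ColoringSearch H k j
  Paths : Set
  Paths = ∀ c d → Proper H c → Proper H d → c ≢ d → PathIn properColorings c d
  paths? : Dec Paths
  paths? = ∀? (colorings H k) λ c → ∀? (colorings H k) λ d →
    proper? H c →-dec proper? H d →-dec ¬? (c ≟ᶜ d) →-dec path? properColorings c d
  joined : Paths → ColGraphConnected H k j
  joined paths = connectedFromDistinct two λ (c , p) (d , q) c≢d →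
    [ (λ c≡d → ⊥-elim (c≢d c≡d)) , (λ path → path) ] (toStar (paths c d p q c≢d) p q)

complete? : ∀ H k j → Dec (ColGraphComplete H k j)
complete? H k j = map′ (λ adjacent (c , p) (d , q) → adjacent c d p q)
                       (λ complete c d p q → complete (c , p) (d , q))
  (∀? (colorings H k) λ c → ∀? (colorings H k) λ d →
     proper? H c →-dec proper? H d →-dec ¬? (c ≟ᶜ d) →-dec locAdj? H k j c d)

hamCycle? : ∀ H k j (L : List (Coloring H k)) → Dec (HamCycle H k j L)
hamCycle? H k j []       = no λ ()
hamCycle? H k j (x ∷ xs) =
  (3 ≤? length (x ∷ xs)) ×-dec all? (proper? H) (x ∷ xs) ×-dec unique? _≟ᶜ_ (x ∷ xs) ×-dec
  covers? ×-dec linked? (locAdj? H k j) ((x ∷ xs) ++ (x ∷ []))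
  where
  open DecMembership _≟ᶜ_ using (_∈?_)
  covers? : Dec (∀ (φ : PColoring H k) → proj₁ φ ∈ x ∷ xs)
  covers? = map′ (λ f (c , p) → f c p) (λ g c p → g (c , p))
    (∀? (colorings H k) λ c → proper? H c →-dec c ∈? (x ∷ xs))

-- A Hamiltonian cycle has no repetitions, so it is among the lists of length at
-- most the number of colorings.
hamiltonian? : ∀ H k j → Dec (ColGraphHamiltonian H k j)
hamiltonian? H k j = complete? H k j ⊎-dec
  map′ satisfied (λ (L , cycle) → lose (candidate L cycle) cycle) (any? (hamCycle? H k j) candidates)
  where
  open Removal (_≟ᶜ_ {k} {n H}) using (unique-length)
  everything : List (Coloring H k)
  everything = elements (colorings H k)
  candidates : List (List (Coloring H k))
  candidates = listsUpTo everything (length everything)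
  candidate : ∀ L → HamCycle H k j L → L ∈ candidates
  candidate (x ∷ xs) (_ , _ , unique , _ , _) = ∈-listsUpTo (colorings H k) _ (x ∷ xs)
    (unique-length unique λ {a} _ → complete (colorings H k) a)

linkedNeighbor : ∀ {A : Set} {R : A → A → Set} {a x y : A} {xs} →
  Linked R (x ∷ y ∷ xs) → a ∈ x ∷ y ∷ xs → ∃ λ b → b ∈ x ∷ y ∷ xs × (R a b ⊎ R b a)
linkedNeighbor {y = y} (r ∷ _) (here refl)         = y , there (here refl) , inj₁ r
linkedNeighbor {x = x} (r ∷ _) (there (here refl)) = x , here refl , inj₂ r
linkedNeighbor {xs = _ ∷ _} (_ ∷ linked) (there (there a∈))
  with b , b∈ , rel ← linkedNeighbor linked (there a∈) = b , there b∈ , rel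

cycleNeighbor : ∀ {A : Set} {R : A → A → Set} {a x : A} xs →
  Linked R ((x ∷ xs) ++ (x ∷ [])) → a ∈ x ∷ xs → ∃ λ b → b ∈ x ∷ xs × (R a b ⊎ R b a)
cycleNeighbor {A} {R} {a} {x} xs linked a∈ =
  let (b , b∈ , rel) = closedNeighbor xs linked (∈-++⁺ˡ a∈) in b , onCycle b∈ , rel
  where
  closedNeighbor : ∀ ys → Linked R ((x ∷ ys) ++ (x ∷ [])) → a ∈ (x ∷ ys) ++ (x ∷ []) →
                    ∃ λ b → b ∈ (x ∷ ys) ++ (x ∷ []) × (R a b ⊎ R b a)
  closedNeighbor []      = linkedNeighbor
  closedNeighbor (_ ∷ _) = linkedNeighbor
  onCycle : ∀ {b} → b ∈ (x ∷ xs) ++ (x ∷ []) → b ∈ x ∷ xs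
  onCycle b∈ with ∈-++⁻ (x ∷ xs) b∈
  ... | inj₁ b∈xs        = b∈xs
  ... | inj₂ (here refl) = here refl

Isolated : (H : Graph) (k j : ℕ) → PColoring H k → Set
Isolated H k j φ = ∀ (ψ : PColoring H k) → ¬ PAdj H k j φ ψ

isolated⇒disconnected : ∀ {H k j} φ → Isolated H k j φ → TwoColorings H k → ¬ ColGraphConnected H k j
isolated⇒disconnected {H} φ isolated two connected with another {H} two φ
... | χ , χ≢φ with connected φ χ
...   | ε                = χ≢φ refl
...   | _◅_ {j = μ} adj _ = isolated μ adj

isolated⇒nonHamiltonian : ∀ {H k j} φ → Isolated H k j φ → TwoColorings H k → ¬ ColGraphHamiltonian H k j
isolated⇒nonHamiltonian {H} φ isolated two (inj₁ complete) =
  let (χ , χ≢φ) = another {H} two φ in isolated χ (complete φ χ (≢-sym χ≢φ))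
isolated⇒nonHamiltonian φ isolated two (inj₂ (x ∷ xs , _ , proper , _ , covers , linked))
  with cycleNeighbor xs linked (covers φ)
... | b , b∈ , inj₁ φ~b = isolated (b , All.lookup proper b∈) φ~b
... | b , b∈ , inj₂ b~φ = isolated (b , All.lookup proper b∈) (locAdj-sym b~φ)

module Thresholds {H : Graph} {k N m : ℕ} (1≤N : 1 ≤ N) (two : TwoColorings H k)
                  (isolated : ∀ j → j < N → ∃ (Isolated H k j)) (complete : ColGraphComplete H k m) where

  mixingNumberAtLeast : ∃ λ g → IsMixingNumber H k g × N ≤ g
  mixingNumberAtLeast =
    leastPositiveAbove (ColGraphConnected H k) (λ j → connected? H k j two) N m 1≤N
      (λ j j<N → let (φ , φ-isolated) = isolated j j<N in isolated⇒disconnected φ φ-isolated two)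
      (complete⇒connected two complete)

  grayCodeNumberAtLeast : ∃ λ h → IsGrayCodeNumber H k h × N ≤ h
  grayCodeNumberAtLeast =
    leastPositiveAbove (ColGraphHamiltonian H k) (hamiltonian? H k) N m 1≤N
      (λ j j<N → let (φ , φ-isolated) = isolated j j<N in isolated⇒nonHamiltonian φ φ-isolated two)
      (inj₁ complete)

differ : ∀ {A : Set} {m} → DecidableEquality A → (xs ys : Vec A m) → xs ≢ ys →
         ∃ λ i → lookup xs i ≢ lookup ys i
differ _≟_ xs ys xs≢ys with Fin.any? (λ i → ¬? (lookup xs i ≟ lookup ys i))
... | yes difference = difference
... | no  none       = ⊥-elim (xs≢ys (begin
    xs                    ≡⟨ tabulate∘lookup xs ⟨
    tabulate (lookup xs)  ≡⟨ tabulate-cong same ⟩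
    tabulate (lookup ys)  ≡⟨ tabulate∘lookup ys ⟩
    ys                    ∎))
  where
  open ≡-Reasoning
  same : ∀ i → lookup xs i ≡ lookup ys i
  same i = decidable-stable (lookup xs i ≟ lookup ys i) λ ne → none (i , ne)

module Grid {a b : ℕ} where

  row : Fin (a * b) → Fin a
  row u = proj₁ (remQuot {a} b u)

  column : Fin (a * b) → Fin b
  column u = proj₂ (remQuot {a} b u)

  row-combine : ∀ (p : Fin a) (c : Fin b) → row (combine p c) ≡ p
  row-combine p c = cong proj₁ (Fin.remQuot-combine p c)

  column-combine : ∀ (p : Fin a) (c : Fin b) → column (combine p c) ≡ c
  column-combine p c = cong proj₂ (Fin.remQuot-combine p c)

  combine-coordinates : ∀ u → combine (row u) (column u) ≡ u
  combine-coordinates u = Fin.combine-remQuot {a} b u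

∣++∣ : ∀ {a b} (xs : Subset a) (ys : Subset b) → ∣ xs ++ᵛ ys ∣ ≡ ∣ xs ∣ + ∣ ys ∣
∣++∣ []           ys = refl
∣++∣ (true ∷ xs)  ys = cong suc (∣++∣ xs ys)
∣++∣ (false ∷ xs) ys = ∣++∣ xs ys

column-counted : ∀ a b (S : Subset (a * b)) (c : Fin b) →
                 (∀ (p : Fin a) → combine p c ∈ˢ S) → a ≤ ∣ S ∣
column-counted zero    b S c _    = z≤n
column-counted (suc a) b S c inS with splitAt b S
... | xs , ys , refl = subst (suc a ≤_) (sym (∣++∣ xs ys))
      (+-mono-≤ (≤-<-trans z≤n (x∈p⇒∣p-x∣<∣p∣ inLeft)) (column-counted a b ys c inRight))
  where
  inLeft : c ∈ˢ xs
  inLeft = lookup⇒[]= c xs (trans (sym (lookup-++ˡ xs ys c)) ([]=⇒lookup (inS zero)))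
  inRight : ∀ (p : Fin a) → combine p c ∈ˢ ys
  inRight p = lookup⇒[]= _ ys (trans (sym (lookup-++ʳ xs ys (combine p c))) ([]=⇒lookup (inS (suc p))))

walk-++ : ∀ {G : Graph} {S x y z} → WalkIn G S x y → WalkIn G S y z → WalkIn G S x z
walk-++ (here _)        rest = rest
walk-++ (step x∈ e walk) rest = step x∈ e (walk-++ walk rest)

walk-reverse : ∀ {G : Graph} {S x y} → WalkIn G S x y → WalkIn G S y x
walk-reverse (here x∈) = here x∈
walk-reverse {G} (step {x} {w} x∈ e walk) =
  walk-++ (walk-reverse walk) (step (start walk) (trans (Graph.sym G w x) e) (here x∈))
  where
  start : ∀ {S a b} → WalkIn G S a b → a ∈ˢ S
  start (here a∈)     = a∈
  start (step a∈ _ _) = a∈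

edge : ∀ {G : Graph} {x y} → adj G x y ≡ true → WalkIn G ⊤ x y
edge e = step ∈⊤ e (here ∈⊤)

connectedViaHub : ∀ {G : Graph} {hub} → (∀ x → WalkIn G ⊤ x hub) → ∀ x y → WalkIn G ⊤ x y
connectedViaHub toHub x y = walk-++ (toHub x) (walk-reverse (toHub y))

cliqueBound : ∀ (G : Graph) {i} (f : Fin i → Vertex G) →
  (∀ p q → p ≢ q → adj G (f p) (f q) ≡ true) → ∀ m → m < i → ¬ Colorable G m
cliqueBound G f clique m m<i (φ , proper)
  with p , q , p<q , same ← Fin.pigeonhole m<i (lookup φ ∘ f) =
  proper (f p) (f q) (clique p q (Fin.<⇒≢ p<q)) same

recolor-proper : ∀ (G : Graph) {k} (σ : Fin k → Fin k) → (∀ a b → σ a ≡ σ b → a ≡ b) →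
  (φ : Coloring G k) → Proper G φ → Proper G (map σ φ)
recolor-proper G σ σ-injective φ proper u v e same = proper u v e (σ-injective _ _ (begin
  σ (lookup φ u)      ≡⟨ lookup-map u σ φ ⟨
  lookup (map σ φ) u  ≡⟨ same ⟩
  lookup (map σ φ) v  ≡⟨ lookup-map v σ φ ⟩
  σ (lookup φ v)      ∎))
  where open ≡-Reasoning

other : ∀ {m} → Fin (suc (suc m)) → Fin (suc (suc m))
other zero    = suc zero
other (suc _) = zero

other-≢ : ∀ {m} (c : Fin (suc (suc m))) → other c ≢ c
other-≢ zero    ()
other-≢ (suc _) ()

swap01 : ∀ {m} → Fin (suc (suc m)) → Fin (suc (suc m))
swap01 zero             = suc zero
swap01 (suc zero)       = zero
swap01 (suc (suc c))    = suc (suc c)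

swap01-involutive : ∀ {m} (c : Fin (suc (suc m))) → swap01 (swap01 c) ≡ c
swap01-involutive zero          = refl
swap01-involutive (suc zero)    = refl
swap01-involutive (suc (suc c)) = refl

swap01-injective : ∀ {m} (a b : Fin (suc (suc m))) → swap01 a ≡ swap01 b → a ≡ b
swap01-injective a b same =
  trans (sym (swap01-involutive a)) (trans (cong swap01 same) (swap01-involutive b))

-- A frozen base: a connected graph of chromatic number i with a proper k-coloring β
-- in which every vertex sees each other color on a neighbor, so that β cannot be
-- changed at a single vertex.
record FrozenBase (i k : ℕ) : Set where
  field
    B         : Graph
    chromatic : ChromaticNumber B i
    connected : ∀ x y → WalkIn B ⊤ x y
    β         : Coloring B k
    β-proper  : Proper B β
    frozen    : ∀ x d → d ≢ lookup β x → ∃ λ y → adj B x y ≡ true × lookup β y ≡ d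
    vertex    : Vertex B

-- The blow-up B[N] of a frozen base: each vertex x of B becomes N pairwise
-- non-adjacent copies combine r x, copies being adjacent exactly when their
-- originals are.  The lifted frozen coloring can only be changed by recoloring
-- a whole column of N copies at once, so it is isolated in G^j_k for j < N,
-- while connectedness of B[N] makes G^j_k complete once j = |V(B[N])|.
module BlowUp {i k′ : ℕ} (base : FrozenBase i (suc (suc k′))) (N′ : ℕ) where
  open FrozenBase base
  open Grid {suc N′} {n B}
  open ≡-Reasoning

  k : ℕ
  k = suc (suc k′)

  N : ℕ
  N = suc N′

  H : Graph
  H = record { n = N * n B ; adj = λ u v → adj B (column u) (column v)
             ; sym = λ u v → Graph.sym B (column u) (column v) ; irrefl = λ v → irrefl B (column v) }

  adj-copies : ∀ r x s y → adj H (combine r x) (combine s y) ≡ adj B x y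
  adj-copies r x s y = cong₂ (adj B) (column-combine r x) (column-combine s y)

  lift : ∀ {c} → Coloring B c → Coloring H c
  lift γ = tabulate (lookup γ ∘ column)

  lookup-lift : ∀ {c} (γ : Coloring B c) u → lookup (lift γ) u ≡ lookup γ (column u)
  lookup-lift γ = lookup∘tabulate (lookup γ ∘ column)

  lookup-lift-copy : ∀ {c} (γ : Coloring B c) r y → lookup (lift γ) (combine r y) ≡ lookup γ y
  lookup-lift-copy γ r y = trans (lookup-lift γ (combine r y)) (cong (lookup γ) (column-combine r y))

  lift-proper : ∀ {c} (γ : Coloring B c) → Proper B γ → Proper H (lift γ)
  lift-proper γ proper u v e same = proper (column u) (column v) e
    (trans (sym (lookup-lift γ u)) (trans same (lookup-lift γ v)))

  restrict : ∀ {c} → Coloring H c → Coloring B c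
  restrict δ = tabulate (lookup δ ∘ combine {N} zero)

  restrict-proper : ∀ {c} (δ : Coloring H c) → Proper H δ → Proper B (restrict δ)
  restrict-proper δ proper x y e same = proper (combine {N} zero x) (combine {N} zero y)
    (trans (adj-copies zero x zero y) e)
    (trans (sym (lookup∘tabulate _ x)) (trans same (lookup∘tabulate _ y)))

  blowUp-chromatic : ChromaticNumber H i
  blowUp-chromatic =
    (let (γ , γ-proper) = proj₁ chromatic in lift γ , lift-proper γ γ-proper) ,
    λ m m<i (δ , δ-proper) → proj₂ chromatic m m<i (restrict δ , restrict-proper δ δ-proper)

  -- A frozen coloring with at least two colors leaves no vertex isolated.
  neighbor : ∀ x → ∃ λ z → adj B x z ≡ true
  neighbor x = let (z , e , _) = frozen x (other (lookup β x)) (other-≢ _) in z , e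

  liftWalk : ∀ r {x y} → WalkIn B ⊤ x y → WalkIn H ⊤ (combine r x) (combine r y)
  liftWalk r (here _)                = here ∈⊤
  liftWalk r (step {w = w} _ e walk) = step ∈⊤ (trans (adj-copies r _ r w) e) (liftWalk r walk)

  -- From u, step to a copy in v's row of a neighbor of u's original, then walk inside that row.
  blowUp-connected : ConnectedSet H ⊤
  blowUp-connected u v _ _ =
    let (z , e) = neighbor (column u) in
    step ∈⊤ (trans (cong (adj B (column u)) (column-combine (row v) z)) e)
      (subst (WalkIn H ⊤ (combine (row v) z)) (combine-coordinates v)
        (liftWalk (row v) (connected z (column v))))

  blowUp-complete : ColGraphComplete H k (N * n B)
  blowUp-complete φ ψ φ≢ψ =
    φ≢ψ , ⊤ , subst (_≤ N * n B) (sym (∣⊤∣≡n _)) ≤-refl , blowUp-connected , λ v _ → ∈⊤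

  frozenLift : PColoring H k
  frozenLift = lift β , lift-proper β β-proper

  -- A proper ψ recoloring u to d differs from the frozen lift on the whole column
  -- of the neighbor y of u's original with β-color d.
  changedColumn : ∀ ψ → Proper H ψ → ∀ u → lookup (lift β) u ≢ lookup ψ u →
                  ∃ λ y → ∀ (r : Fin N) → lookup (lift β) (combine r y) ≢ lookup ψ (combine r y)
  changedColumn ψ ψ-proper u changed =
    let (y , e , βy≡ψu) = frozen (column u) (lookup ψ u)
                            (λ same → changed (trans (lookup-lift β u) (sym same))) in
    y , λ r unchanged → ψ-proper u (combine r y)
      (trans (cong (adj B (column u)) (column-combine r y)) e) (begin
        lookup ψ u                     ≡⟨ βy≡ψu ⟨
        lookup β y                     ≡⟨ lookup-lift-copy β r y ⟨
        lookup (lift β) (combine r y)  ≡⟨ unchanged ⟩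
        lookup ψ (combine r y)         ∎)

  frozenLift-isolated : ∀ j → j < N → Isolated H k j frozenLift
  frozenLift-isolated j j<N (ψ , ψ-proper) (φ≢ψ , S , small , _ , covers) =
    let (u , changed) = differ _≟ᶠ_ (lift β) ψ φ≢ψ
        (y , column-changed) = changedColumn ψ ψ-proper u changed in
    n≮n N (≤-<-trans (≤-trans (column-counted N (n B) S y λ r → covers _ (column-changed r)) small)
                     j<N)

  -- Exchanging colors 0 and 1 gives a second proper coloring, different because β uses color 0.
  swappedLift : PColoring H k
  swappedLift = lift (map swap01 β) ,
                lift-proper (map swap01 β) (recolor-proper B swap01 swap01-injective β β-proper)

  coloredZero : ∃ λ y → lookup β y ≡ zero
  coloredZero with lookup β vertex ≟ᶠ zero
  ... | yes βv≡0 = vertex , βv≡0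
  ... | no βv≢0  = let (y , _ , βy≡0) = frozen vertex zero (≢-sym βv≢0) in y , βy≡0

  two : TwoColorings H k
  two = frozenLift , swappedLift , λ same →
    let (y , βy≡0) = coloredZero
        u = combine {N} zero y in
    zero≢one (begin
      zero                            ≡⟨ βy≡0 ⟨
      lookup β y                      ≡⟨ lookup-lift-copy β zero y ⟨
      lookup (lift β) u               ≡⟨ cong (λ γ → lookup γ u) same ⟩
      lookup (lift (map swap01 β)) u  ≡⟨ lookup-lift-copy (map swap01 β) zero y ⟩
      lookup (map swap01 β) y         ≡⟨ lookup-map y swap01 β ⟩
      swap01 (lookup β y)             ≡⟨ cong swap01 βy≡0 ⟩
      suc zero                        ∎)
    where
    zero≢one : zero ≢ Fin.suc {suc k′} zero
    zero≢one ()

fromDoes : ∀ {A : Set} (a? : Dec A) → does a? ≡ true → A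
fromDoes (yes a) _ = a

completeGraph : ℕ → Graph
completeGraph m = record
  { n = m ; adj = λ u v → does (¬? (u ≟ᶠ v))
  ; sym = λ u v → does-⇔ (mk⇔ ≢-sym ≢-sym) (¬? (u ≟ᶠ v)) (¬? (v ≟ᶠ u))
  ; irrefl = λ v → dec-false (¬? (v ≟ᶠ v)) (λ v≢v → v≢v refl) }

completeBase : ∀ m → FrozenBase (suc m) (suc m)
completeBase m = record
  { B = K ; chromatic = (identity , identity-proper) , cliqueBound K id λ p q → dec-true (¬? (p ≟ᶠ q))
  ; connected = connected ; β = identity ; β-proper = identity-proper ; frozen = frozen ; vertex = zero }
  where
  K : Graph
  K = completeGraph (suc m)
  identity : Coloring K (suc m)
  identity = tabulate id
  identity-proper : Proper K identity
  identity-proper u v e same =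
    fromDoes (¬? (u ≟ᶠ v)) e (trans (sym (lookup∘tabulate id u)) (trans same (lookup∘tabulate id v)))
  connected : ∀ x y → WalkIn K ⊤ x y
  connected x y with x ≟ᶠ y
  ... | yes refl = here ∈⊤
  ... | no x≢y   = edge (dec-true (¬? (x ≟ᶠ y)) x≢y)
  frozen : ∀ x d → d ≢ lookup identity x → ∃ λ y → adj K x y ≡ true × lookup identity y ≡ d
  frozen x d d≢x =
    d , dec-true (¬? (x ≟ᶠ d)) (≢-sym (λ d≡x → d≢x (trans d≡x (sym (lookup∘tabulate id x))))) ,
    lookup∘tabulate id d

fresh : ∀ {m} → Fin (suc (suc (suc m))) → Fin (suc (suc (suc m)))
fresh zero          = suc zero
fresh (suc zero)    = suc (suc zero)
fresh (suc (suc _)) = suc zero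

fresh-≢ : ∀ {m} (c : Fin (suc (suc (suc m)))) → fresh c ≢ c
fresh-≢ zero          ()
fresh-≢ (suc zero)    ()
fresh-≢ (suc (suc _)) ()

fresh-≢0 : ∀ {m} (c : Fin (suc (suc (suc m)))) → fresh c ≢ zero
fresh-≢0 zero          ()
fresh-≢0 (suc zero)    ()
fresh-≢0 (suc (suc _)) ()

-- The column coloring is frozen, the row
-- coloring shows χ ≤ i, and a diagonal is an i-clique.
module ProductBase (i′ k″ : ℕ) (i≤k : suc (suc i′) ≤ suc (suc (suc k″))) where
  i k : ℕ
  i = suc (suc i′)
  k = suc (suc (suc k″))
  open Grid {i} {k}
  open ≡-Reasoning

  cell : Fin i → Fin k → Fin (i * k)
  cell = combine

  Adjacent : Fin (i * k) → Fin (i * k) → Set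
  Adjacent u v = row u ≢ row v × column u ≢ column v

  adjacent? : ∀ u v → Dec (Adjacent u v)
  adjacent? u v = ¬? (row u ≟ᶠ row v) ×-dec ¬? (column u ≟ᶠ column v)

  G : Graph
  G = record
    { n = i * k ; adj = λ u v → does (adjacent? u v)
    ; sym = λ u v → does-⇔ (mk⇔ (swapped u v) (swapped v u)) (adjacent? u v) (adjacent? v u)
    ; irrefl = λ v → dec-false (adjacent? v v) (λ (r≢r , _) → r≢r refl) }
    where
    swapped : ∀ u v → Adjacent u v → Adjacent v u
    swapped _ _ (r≢ , c≢) = ≢-sym r≢ , ≢-sym c≢

  adjacent : ∀ (p : Fin i) (c : Fin k) (p′ : Fin i) (c′ : Fin k) → p ≢ p′ → c ≢ c′ →
             adj G (cell p c) (cell p′ c′) ≡ true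
  adjacent p c p′ c′ p≢p′ c≢c′ = dec-true (adjacent? (cell p c) (cell p′ c′))
    ( (λ same → p≢p′ (trans (sym (row-combine p c)) (trans same (row-combine p′ c′))))
    , (λ same → c≢c′ (trans (sym (column-combine p c)) (trans same (column-combine p′ c′)))))

  coordinateColoring-proper : ∀ {m} (coordinate : Fin (i * k) → Fin m) →
    (∀ u v → Adjacent u v → coordinate u ≢ coordinate v) → Proper G (tabulate coordinate)
  coordinateColoring-proper coordinate separated u v e same = separated u v (fromDoes (adjacent? u v) e)
    (trans (sym (lookup∘tabulate coordinate u)) (trans same (lookup∘tabulate coordinate v)))

  β : Coloring G k
  β = tabulate column

  diagonal : Fin i → Fin (i * k)
  diagonal p = cell p (inject≤ p i≤k)

  frozen : ∀ x d → d ≢ lookup β x → ∃ λ y → adj G x y ≡ true × lookup β y ≡ d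
  frozen x d d≢βx = cell (other (row x)) d ,
    subst (λ w → adj G w (cell (other (row x)) d) ≡ true) (combine-coordinates x)
      (adjacent (row x) (column x) (other (row x)) d (≢-sym (other-≢ (row x)))
        (λ column≡d → d≢βx (trans (sym column≡d) (sym (lookup∘tabulate column x))))) ,
    trans (lookup∘tabulate column (cell (other (row x)) d)) (column-combine (other (row x)) d)

  hub : Fin (i * k)
  hub = cell zero zero

  toHub : ∀ (p : Fin i) (c : Fin k) → WalkIn G ⊤ (cell p c) hub
  toHub zero c = walk-++ {y = cell (suc zero) (fresh c)}
    (edge (adjacent zero c (suc zero) (fresh c) (λ ()) (≢-sym (fresh-≢ c))))
    (edge (adjacent (suc zero) (fresh c) zero zero (λ ()) (fresh-≢0 c)))
  toHub (suc p) (suc c) = edge (adjacent (suc p) (suc c) zero zero (λ ()) (λ ()))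
  toHub (suc p) zero    = walk-++ {y = cell zero (suc zero)}
    (edge (adjacent (suc p) zero zero (suc zero) (λ ()) (λ ())))
    (toHub zero (suc zero))

  base : FrozenBase i k
  base = record
    { B = G
    ; chromatic = (tabulate row , coordinateColoring-proper row (λ _ _ → proj₁)) ,
                  cliqueBound G diagonal λ p q p≢q → adjacent p _ q _ p≢q
                    (p≢q ∘ Fin.inject≤-injective i≤k i≤k p q)
    ; connected = connectedViaHub λ u →
        subst (λ w → WalkIn G ⊤ w hub) (combine-coordinates u) (toHub (row u) (column u))
    ; β = β ; β-proper = coordinateColoring-proper column (λ _ _ → proj₂) ; frozen = frozen ; vertex = zero }

frozenBase : ∀ i′ k′ → i′ ≤ k′ → FrozenBase (suc (suc i′)) (suc (suc k′))
frozenBase zero zero     z≤n   = completeBase 1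
frozenBase i′   (suc k″) i′≤k′ = ProductBase.base i′ k″ (s≤s (s≤s i′≤k′))

unbounded : ∀ {i k′} → FrozenBase i (suc (suc k′)) → ∀ N → 1 ≤ N →
  (∃ λ (H : Graph) → ChromaticNumber H i × ∃ λ g → IsMixingNumber H (suc (suc k′)) g × N ≤ g) ×
  (∃ λ (H : Graph) → ChromaticNumber H i × ∃ λ h → IsGrayCodeNumber H (suc (suc k′)) h × N ≤ h)
unbounded base (suc N′) 1≤N =
  (H , blowUp-chromatic , mixingNumberAtLeast) , (H , blowUp-chromatic , grayCodeNumberAtLeast)
  where
  open BlowUp base N′
  open Thresholds 1≤N two (λ j j<N → frozenLift , frozenLift-isolated j j<N) blowUp-complete

mainTheorem1 : (i k : ℕ) → 1 < i → i ≤ k → (N : ℕ) → 1 ≤ N →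
    (∃ λ (H : Graph) → ChromaticNumber H i × ∃ λ g → IsMixingNumber H k g × N ≤ g) ×
    (∃ λ (H' : Graph) → ChromaticNumber H' i × ∃ λ h → IsGrayCodeNumber H' k h × N ≤ h)
mainTheorem1 (suc (suc i′)) (suc (suc k′)) (s≤s (s≤s z≤n)) (s≤s (s≤s i′≤k′)) =
  unbounded (frozenBase i′ k′ i′≤k′)
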